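{- Let $k\ge 1$, $n\ge1$, and let $S\subseteq\{1,2,\ldots,\lfloor n/2\rfloor\}$. Then (a) if $n$ is odd, $\mathrm{opp}_{k,S}(n) = \mathrm{epp}_{k,S}(n)$; and (b) if $n$ is even, $\mathrm{opp}_{k,S}(n) = k\cdot \mathrm{epp}_{k,S}(n-1)$.
   Context: $\Sigma_k = \{0,\ldots,k-1\}$. A palindrome is a word equal to its reverse. A word $w$ has an even palindromic prefix of order $i\ge1$ if $w[1..2i]$ exists and is a palindrome, and an odd palindromic prefix of order $i\ge 1$ if $w[1..2i+1]$ exists and is a palindrome. $\mathrm{epp}_{k,S}(n)$ (resp. $\mathrm{opp}_{k,S}(n)$) is the number of length-$n$ words over $\Sigma_k$ whose set of orders $i\ge1$ of even (resp. odd) palindromic prefixes is exactly $S$. -}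

module Defs where

open import Data.Nat using (ℕ; zero; suc; _+_; _*_; _≤_; _<_)
open import Data.Fin using (Fin)
open import Data.Vec using (Vec; reverse; take; cast)
open import Data.List using (List; length)
open import Data.List.Membership.Propositional using (_∈_)
open import Data.List.Relation.Unary.Unique.Propositional using (Unique)
open import Data.Product using (Σ; _×_; ∃-syntax)
open import Relation.Binary.PropositionalEquality using (_≡_)
open import Function.Bundles using (_⇔_)

Word : ℕ → ℕ → Set
Word k n = Vec (Fin k) n

IsPalindrome : ∀ {k m} → Word k m → Set
IsPalindrome w = reverse w ≡ w

-- w[1..m] exists (m ≤ n) and is a palindrome
PalPrefix : ∀ {k n} → Word k n → ℕ → Set
PalPrefix {k} {n} w m =
  Σ ℕ λ r → Σ (n ≡ m + r) λ eq → IsPalindrome (take m (cast eq w))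

EvenPP : ∀ {k n} → Word k n → ℕ → Set
EvenPP w i = PalPrefix w (i + i)

OddPP : ∀ {k n} → Word k n → ℕ → Set
OddPP w i = PalPrefix w (suc (i + i))

OrdersExactly : (ℕ → Set) → (ℕ → Set) → Set
OrdersExactly P S = ∀ i → 1 ≤ i → (P i ⇔ S i)

HasCount : ∀ k n → (Word k n → Set) → ℕ → Set
HasCount k n P c =
  Σ (List (Word k n)) λ l → Unique l × (∀ w → (w ∈ l ⇔ P w)) × (length l ≡ c)

Epp : ∀ k → (ℕ → Set) → ∀ n → ℕ → Set
Epp k S n c = HasCount k n (λ w → OrdersExactly (EvenPP w) S) c

Opp : ∀ k → (ℕ → Set) → ∀ n → ℕ → Set
Opp k S n c = HasCount k n (λ w → OrdersExactly (OddPP w) S) c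

-- Write ℓ_p(i) = 2i + p for the length of a palindromic prefix of order i, with p = 0 (even) or
-- p = 1 (odd). For a fixed length n and a finite set T of orders, the number of words having
-- palindromic prefixes of length ℓ_p(i) for all i ∈ T does not depend on p. Let t be the largest
-- order in T and s the next one. If t ≤ 2s, palindromic prefixes of lengths ℓ_p(s) and ℓ_p(t) give
-- the prefix of length ℓ_p(t) the period 2(t − s); this is equivalent to a palindromic prefix of
-- order 2s − t with the 2(t − s) letters after position ℓ_p(s) forced. If t > 2s, the prefix of
-- length ℓ_p(t) is the one of length ℓ_p(s), a palindrome of length 2(t − 2s) − p, and the mirror
-- of the first part, which contributes k^(t − 2s) choices. In both cases the counts for p = 0 and
-- p = 1 change by the same factor and T gets a smaller largest order, so induction applies.
-- Inclusion–exclusion passes from "at least the orders in T" to "exactly the orders in S". For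
-- even n = 2m + 2, odd prefixes of orders ≤ m only involve the first 2m + 1 letters, whence the
-- factor k.

module Submission where

open import Defs
open import Data.Nat
  using (ℕ; zero; suc; pred; _+_; _*_; _^_; _∸_; _≤_; _<_; _≤ᵇ_; _≤?_; _<?_; _/_; z≤n; s≤s; NonZero; >-nonZero)
open import Data.Nat.Properties
open import Data.Nat.Solver using (module +-*-Solver)
open import Data.Bool using (Bool; true; false; _∧_; _∨_; not; if_then_else_; T)
open import Data.Bool.Properties using (∧-identityʳ; ∧-zeroʳ; ∧-comm)
open import Data.Fin using (Fin; zero; suc)
import Data.Fin.Properties as Fin
open import Data.List using (List; []; _∷_; [_]; _++_; map; length; concat; tabulate; take; drop; reverse; filter; applyUpTo)
open import Data.List.Properties as List
  using (≡-dec; length-take; take-take; take-[]; ++-assoc; reverse-++; reverse-involutive; length-reverse;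
         length-drop; take++drop≡id)
open import Data.List.Relation.Unary.All as All using (All; []; _∷_)
open import Data.List.Relation.Unary.All.Properties using (All¬⇒¬Any; all-filter; filter⁺; filter⁻)
open import Data.List.Relation.Unary.Any using (here; there)
open import Data.List.Relation.Unary.Unique.Propositional using (Unique; _∷_)
open import Data.List.Membership.Propositional using (_∈_)
open import Data.List.Membership.Propositional.Properties using (∈-filter⁻; ∈-applyUpTo⁺; ∈-applyUpTo⁻)
import Data.List.Membership.DecPropositional as DecMembership
open import Data.List.Extrema.Nat using (max; ⊥≤max; xs≤max; argmax-all)
open import Data.Vec as Vec using (Vec; []; _∷_; toList)
import Data.Vec.Properties as Vec
open import Data.Product using (_×_; _,_; proj₁; proj₂)
open import Data.Empty using (⊥; ⊥-elim)
open import Function using (_∘_; _∘′_; _⇔_; mk⇔; Equivalence)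
open import Relation.Binary using (DecidableEquality)
open import Relation.Binary.PropositionalEquality hiding ([_])
open import Relation.Nullary using (yes; no; ¬_; does; ¬?)
open import Algebra.Properties.Semiring.Sum +-*-semiring using (sum-cong-≗; *-distribʳ-sum)
  renaming (sum to ∑)
open +-*-Solver using (solve; _:+_; _:*_; _:=_)
open ≡-Reasoning

bool-ext : ∀ {b c : Bool} → (b ≡ true → c ≡ true) → (c ≡ true → b ≡ true) → b ≡ c
bool-ext {true}  {true}  _ _ = refl
bool-ext {true}  {false} f _ = sym (f refl)
bool-ext {false} {true}  _ g = g refl
bool-ext {false} {false} _ _ = refl

∧≡true⇒ : ∀ {a b} → a ∧ b ≡ true → a ≡ true × b ≡ true
∧≡true⇒ {true} {true} _ = refl , refl

private variable A B : Set

count : (A → Bool) → List A → ℕ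
count f []       = 0
count f (x ∷ xs) = if f x then suc (count f xs) else count f xs

count-cong : ∀ {f g : A → Bool} xs → (∀ x → f x ≡ g x) → count f xs ≡ count g xs
count-cong []       _ = refl
count-cong (x ∷ xs) f≗g =
  cong₂ (λ b c → if b then suc c else c) (f≗g x) (count-cong xs f≗g)

count-false : (xs : List A) → count (λ _ → false) xs ≡ 0
count-false []       = refl
count-false (_ ∷ xs) = count-false xs

count-++ : ∀ (f : A → Bool) xs ys → count f (xs ++ ys) ≡ count f xs + count f ys
count-++ f []       ys = refl
count-++ f (x ∷ xs) ys with f x
... | true  = cong suc (count-++ f xs ys)
... | false = count-++ f xs ys

count-map : ∀ f (g : B → A) xs → count f (map g xs) ≡ count (f ∘ g) xs
count-map f g []       = refl
count-map f g (x ∷ xs) with f (g x)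
... | true  = cong suc (count-map f g xs)
... | false = count-map f g xs

count-concat-tabulate : ∀ (f : A → Bool) {m} (F : Fin m → List A) → count f (concat (tabulate F)) ≡ ∑ (count f ∘ F)
count-concat-tabulate f {zero}  F = refl
count-concat-tabulate f {suc m} F =
  trans (count-++ f (F zero) _) (cong (count f (F zero) +_) (count-concat-tabulate f (F ∘ suc)))

count-∧-∧¬ : ∀ (f g : A → Bool) xs → count f xs ≡ count (λ x → f x ∧ g x) xs + count (λ x → f x ∧ not (g x)) xs
count-∧-∧¬ f g []       = refl
count-∧-∧¬ f g (x ∷ xs) with f x | g x
... | true  | true  = cong suc (count-∧-∧¬ f g xs)
... | true  | false = trans (cong suc (count-∧-∧¬ f g xs)) (sym (+-suc _ _))
... | false | _     = count-∧-∧¬ f g xs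

count-∨ : ∀ (f g : A → Bool) xs → (∀ x → f x ∧ g x ≡ false) →
          count (λ x → f x ∨ g x) xs ≡ count f xs + count g xs
count-∨ f g []       _ = refl
count-∨ f g (x ∷ xs) disjoint with f x | g x | disjoint x
... | true  | false | _ = cong suc (count-∨ f g xs disjoint)
... | false | true  | _ = trans (cong suc (count-∨ f g xs disjoint)) (sym (+-suc _ _))
... | false | false | _ = count-∨ f g xs disjoint

module BoolEquality {A : Set} (_≟_ : DecidableEquality A) where

  open DecMembership _≟_ using (_∈?_)

  -- Opaque, so that x == y is not unfolded into the decision procedure and unification can
  -- still recover x and y.
  opaque
    _==_ : A → A → Bool
    x == y = does (x ≟ y)

    ==⇒≡ : ∀ {x y} → x == y ≡ true → x ≡ y
    ==⇒≡ {x} {y} h with x ≟ y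
    ... | yes x≡y = x≡y

    ≡⇒== : ∀ {x y} → x ≡ y → x == y ≡ true
    ≡⇒== {x} {y} x≡y with x ≟ y
    ... | yes _   = refl
    ... | no x≢y = ⊥-elim (x≢y x≡y)

    ≢⇒== : ∀ {x y} → ¬ x ≡ y → x == y ≡ false
    ≢⇒== {x} {y} x≢y with x ≟ y
    ... | yes x≡y = ⊥-elim (x≢y x≡y)
    ... | no _    = refl

    _∈ᵇ_ : A → List A → Bool
    x ∈ᵇ l = does (x ∈? l)

    ∈ᵇ⇔∈ : ∀ {x l} → x ∈ᵇ l ≡ true ⇔ x ∈ l
    ∈ᵇ⇔∈ {x} {l} = mk⇔ to from
      where
      to : x ∈ᵇ l ≡ true → x ∈ l
      to h with x ∈? l
      ... | yes x∈l = x∈l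
      from : x ∈ l → x ∈ᵇ l ≡ true
      from x∈l with x ∈? l
      ... | yes _   = refl
      ... | no x∉l = ⊥-elim (x∉l x∈l)

    ∈ᵇ-[] : ∀ x → x ∈ᵇ [] ≡ false
    ∈ᵇ-[] x = refl

    ∈ᵇ-∷ : ∀ x y l → x ∈ᵇ (y ∷ l) ≡ (x == y ∨ x ∈ᵇ l)
    ∈ᵇ-∷ x y l with x ≟ y
    ... | yes _ = refl
    ... | no _  = refl

  count-∈ᵇ-Unique : (E : List A) → (∀ y → count (_== y) E ≡ 1) →
                    ∀ l → Unique l → count (_∈ᵇ l) E ≡ length l
  count-∈ᵇ-Unique E once []      _          = trans (count-cong E ∈ᵇ-[]) (count-false E)
  count-∈ᵇ-Unique E once (y ∷ l) (y∉l ∷ l!) = begin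
    count (_∈ᵇ (y ∷ l)) E                 ≡⟨ count-cong E (λ x → ∈ᵇ-∷ x y l) ⟩
    count (λ x → x == y ∨ x ∈ᵇ l) E       ≡⟨ count-∨ (_== y) (_∈ᵇ l) E disjoint ⟩
    count (_== y) E + count (_∈ᵇ l) E     ≡⟨ cong₂ _+_ (once y) (count-∈ᵇ-Unique E once l l!) ⟩
    suc (length l)                        ∎
    where
    disjoint : ∀ x → x == y ∧ x ∈ᵇ l ≡ false
    disjoint x with x == y in x=y | x ∈ᵇ l in x∈l
    ... | false | _     = refl
    ... | true  | false = refl
    ... | true  | true  = ⊥-elim (All¬⇒¬Any y∉l
                            (subst (_∈ l) (==⇒≡ x=y) (Equivalence.to ∈ᵇ⇔∈ x∈l)))

-- Lists and palindromes

module _ {A : Set} where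

  take-+ : ∀ m n (xs : List A) → take (m + n) xs ≡ take m xs ++ take n (drop m xs)
  take-+ zero    n xs       = refl
  take-+ (suc m) n []       = sym (take-[] n)
  take-+ (suc m) n (x ∷ xs) = cong (x ∷_) (take-+ m n xs)

  take-++ : ∀ (xs ys : List A) {n} → length xs ≡ n → take n (xs ++ ys) ≡ xs
  take-++ []       ys refl = refl
  take-++ (x ∷ xs) ys refl = cong (x ∷_) (take-++ xs ys refl)

  drop-++ : ∀ (xs ys : List A) {n} → length xs ≡ n → drop n (xs ++ ys) ≡ ys
  drop-++ []       ys refl = refl
  drop-++ (x ∷ xs) ys refl = drop-++ xs ys refl

  ++-cancel-length : ∀ (xs ys xs′ ys′ : List A) → length xs ≡ length xs′ →
                     xs ++ ys ≡ xs′ ++ ys′ → xs ≡ xs′ × ys ≡ ys′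
  ++-cancel-length xs ys xs′ ys′ len eq =
    trans (sym (take-++ xs ys refl)) (trans (cong (take (length xs)) eq) (take-++ xs′ ys′ (sym len))) ,
    trans (sym (drop-++ xs ys refl)) (trans (cong (drop (length xs)) eq) (drop-++ xs′ ys′ (sym len)))

  length-take-≤ : ∀ n (xs : List A) → n ≤ length xs → length (take n xs) ≡ n
  length-take-≤ n xs n≤ = trans (length-take n xs) (m≤n⇒m⊓n≡m n≤)

  take-take-≤ : ∀ m n (xs : List A) → m ≤ n → take m (take n xs) ≡ take m xs
  take-take-≤ m n xs m≤n = trans (take-take m n xs) (cong (λ i → take i xs) (m≤n⇒m⊓n≡m m≤n))

  reverse-++-++ : ∀ (x y z : List A) → reverse (x ++ y ++ z) ≡ reverse z ++ reverse y ++ reverse x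
  reverse-++-++ x y z = begin
    reverse (x ++ y ++ z)                 ≡⟨ reverse-++ x (y ++ z) ⟩
    reverse (y ++ z) ++ reverse x         ≡⟨ cong (_++ reverse x) (reverse-++ y z) ⟩
    (reverse z ++ reverse y) ++ reverse x ≡⟨ ++-assoc (reverse z) (reverse y) (reverse x) ⟩
    reverse z ++ reverse y ++ reverse x   ∎

  drop-reverse : ∀ d (u : List A) → d ≤ length u → drop d (reverse u) ≡ reverse (take (length u ∸ d) u)
  drop-reverse d u d≤ = begin
    drop d (reverse u)                          ≡⟨ cong (drop d ∘′ reverse) (take++drop≡id c u) ⟨
    drop d (reverse (take c u ++ drop c u))     ≡⟨ cong (drop d) (reverse-++ (take c u) (drop c u)) ⟩
    drop d (reverse (drop c u) ++ reverse (take c u)) ≡⟨ drop-++ (reverse (drop c u)) _ len ⟩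
    reverse (take c u)                          ∎
    where
    c = length u ∸ d
    len : length (reverse (drop c u)) ≡ d
    len = trans (length-reverse (drop c u)) (trans (length-drop c u) (m∸[m∸n]≡n d≤))

module Palindromes {A : Set} (_≟_ : DecidableEquality A) where

  open BoolEquality (≡-dec _≟_) public

  isPal : List A → Bool
  isPal w = reverse w == w

  isPal⇒ : ∀ w → isPal w ≡ true → reverse w ≡ w
  isPal⇒ w = ==⇒≡

  ⇒isPal : ∀ w → reverse w ≡ w → isPal w ≡ true
  ⇒isPal w = ≡⇒== {reverse w} {w}

  isPal-reverse : ∀ v → isPal (reverse v) ≡ isPal v
  isPal-reverse v = bool-ext
    (λ h → ⇒isPal v (sym (trans (sym (reverse-involutive v)) (isPal⇒ (reverse v) h))))
    (λ h → ⇒isPal (reverse v) (cong reverse (isPal⇒ v h)))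

  isPal-short : ∀ (y : List A) → length y ≤ 1 → isPal y ≡ true
  isPal-short []          _ = ⇒isPal [] refl
  isPal-short (x ∷ [])    _ = ⇒isPal (x ∷ []) refl
  isPal-short (_ ∷ _ ∷ _) (s≤s ())

  isPal-++-++ : ∀ x y z → length z ≡ length x → isPal (x ++ y ++ z) ≡ (z == reverse x) ∧ isPal y
  isPal-++-++ x y z len = bool-ext to from
    where
    to : isPal (x ++ y ++ z) ≡ true → (z == reverse x) ∧ isPal y ≡ true
    to h =
      let (rz≡x , rest) = ++-cancel-length (reverse z) _ x (y ++ z) (trans (length-reverse z) len)
                            (trans (sym (reverse-++-++ x y z)) (isPal⇒ (x ++ y ++ z) h))
          (ry≡y , _) = ++-cancel-length (reverse y) (reverse x) y z (length-reverse y) rest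
      in cong₂ _∧_ (≡⇒== (trans (sym (reverse-involutive z)) (cong reverse rz≡x))) (⇒isPal y ry≡y)
    from : (z == reverse x) ∧ isPal y ≡ true → isPal (x ++ y ++ z) ≡ true
    from h with ∧≡true⇒ {z == reverse x} h
    ... | z≡ , y-pal = subst (λ q → isPal (x ++ y ++ q) ≡ true) (sym (==⇒≡ z≡)) (⇒isPal (x ++ y ++ reverse x) (begin
      reverse (x ++ y ++ reverse x)                           ≡⟨ reverse-++-++ x y (reverse x) ⟩
      reverse (reverse x) ++ reverse y ++ reverse x           ≡⟨ cong₂ (λ a b → a ++ b ++ reverse x)
                                                                   (reverse-involutive x) (isPal⇒ y y-pal) ⟩
      x ++ y ++ reverse x                                     ∎))

  -- Reflecting through the centre of u turns "the suffix drop d u is a palindrome" into the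
  -- same statement for the prefix of length |u| - d.
  isPal-extend : ∀ u t d → isPal u ≡ true → d ≤ length u → length t ≡ d →
                 isPal (u ++ t) ≡ (t == reverse (take d u)) ∧ isPal (take (length u ∸ d) u)
  isPal-extend u t d u-pal d≤ len = begin
    isPal (u ++ t)                                            ≡⟨ cong (λ v → isPal (v ++ t)) (take++drop≡id d u) ⟨
    isPal ((take d u ++ drop d u) ++ t)                       ≡⟨ cong isPal (++-assoc (take d u) (drop d u) t) ⟩
    isPal (take d u ++ drop d u ++ t)                         ≡⟨ isPal-++-++ (take d u) (drop d u) t
                                                                   (trans len (sym (length-take-≤ d u d≤))) ⟩
    mirror ∧ isPal (drop d u)                                 ≡⟨ cong (λ v → mirror ∧ isPal (drop d v)) (isPal⇒ u u-pal) ⟨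
    mirror ∧ isPal (drop d (reverse u))                       ≡⟨ cong (λ v → mirror ∧ isPal v) (drop-reverse d u d≤) ⟩
    mirror ∧ isPal (reverse (take (length u ∸ d) u))          ≡⟨ cong (mirror ∧_) (isPal-reverse (take (length u ∸ d) u)) ⟩
    mirror ∧ isPal (take (length u ∸ d) u)                    ∎
    where mirror = t == reverse (take d u)

  palPrefix : ℕ → List A → Bool
  palPrefix L w = (L ≤ᵇ length w) ∧ isPal (take L w)

  palPrefix-≤ : ∀ L w → L ≤ length w → palPrefix L w ≡ isPal (take L w)
  palPrefix-≤ L w L≤ with L ≤ᵇ length w | ≤⇒≤ᵇ L≤
  ... | true | _ = refl

  palPrefix-> : ∀ L w → length w < L → palPrefix L w ≡ false
  palPrefix-> L w w< with L ≤ᵇ length w in eq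
  ... | true  = ⊥-elim (<⇒≱ w< (≤ᵇ⇒≤ L (length w) (subst T (sym eq) _)))
  ... | false = refl

  palPrefix⇒≤ : ∀ L w → palPrefix L w ≡ true → L ≤ length w
  palPrefix⇒≤ L w h with L ≤ᵇ length w in eq
  ... | true = ≤ᵇ⇒≤ L (length w) (subst T (sym eq) _)

  palPrefix⇒isPal : ∀ L w → palPrefix L w ≡ true → isPal (take L w) ≡ true
  palPrefix⇒isPal L w h = proj₂ (∧≡true⇒ {L ≤ᵇ length w} h)

  palPrefix-take : ∀ L a w → L ≤ a → a ≤ length w → palPrefix L w ≡ palPrefix L (take a w)
  palPrefix-take L a w L≤a a≤ = begin
    palPrefix L w             ≡⟨ palPrefix-≤ L w (≤-trans L≤a a≤) ⟩
    isPal (take L w)          ≡⟨ cong isPal (take-take-≤ L a w L≤a) ⟨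
    isPal (take L (take a w)) ≡⟨ palPrefix-≤ L (take a w) (≤-trans L≤a (≤-reflexive (sym (length-take-≤ a w a≤)))) ⟨
    palPrefix L (take a w)    ∎

-- Words of a given length

∑-const : ∀ m c → ∑ {m} (λ _ → c) ≡ m * c
∑-const zero    c = refl
∑-const (suc m) c = cong (c +_) (∑-const m c)

∑-indicator : ∀ {m} (y : Fin m) (f : Fin m → ℕ) → (∀ x → ¬ x ≡ y → f x ≡ 0) → ∑ f ≡ f y
∑-indicator {suc m} zero    f f0 =
  trans (cong (f zero +_) (trans (sum-cong-≗ (λ x → f0 (suc x) λ ())) (∑-const m 0)))
        (trans (cong (f zero +_) (*-zeroʳ m)) (+-identityʳ (f zero)))
∑-indicator {suc m} (suc y) f f0 =
  trans (cong (_+ ∑ (f ∘ suc)) (f0 zero λ ()))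
        (∑-indicator y (f ∘ suc) (λ x x≢y → f0 (suc x) (x≢y ∘ Fin.suc-injective)))

module WordCounting (k : ℕ) where

  open Palindromes (Fin._≟_ {k}) public

  Str : Set
  Str = List (Fin k)

  words : (n : ℕ) → List (Vec (Fin k) n)
  words zero    = [ [] ]
  words (suc n) = concat (tabulate λ x → map (x ∷_) (words n))

  opaque
    #[_]_ : ℕ → (Str → Bool) → ℕ
    #[ n ] f = count (f ∘ toList) (words n)

    #-suc : ∀ n f → #[ suc n ] f ≡ ∑ (λ x → #[ n ] (λ w → f (x ∷ w)))
    #-suc n f = trans (count-concat-tabulate (f ∘ toList) (λ x → map (x ∷_) (words n)))
                      (sum-cong-≗ {k} λ x → count-map (f ∘ toList) (x ∷_) (words n))

    #-cong : ∀ n {f g : Str → Bool} → (∀ w → length w ≡ n → f w ≡ g w) → #[ n ] f ≡ #[ n ] g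
    #-cong n f≗g = count-cong (words n) (λ v → f≗g (toList v) (Vec.length-toList v))

    #-false : ∀ n → #[ n ] (λ _ → false) ≡ 0
    #-false n = count-false (words n)

    #-zero : ∀ f → #[ 0 ] f ≡ (if f [] then 1 else 0)
    #-zero f = refl

    #-split : ∀ n (f g : Str → Bool) → #[ n ] f ≡ #[ n ] (λ w → f w ∧ g w) + #[ n ] (λ w → f w ∧ not (g w))
    #-split n f g = count-∧-∧¬ (f ∘ toList) (g ∘ toList) (words n)

  #-true : ∀ n → #[ n ] (λ _ → true) ≡ k ^ n
  #-true zero    = #-zero (λ _ → true)
  #-true (suc n) = trans (#-suc n _) (trans (sum-cong-≗ {k} (λ _ → #-true n)) (∑-const k (k ^ n)))

  #-product : ∀ a r (f : Str → Bool) (g : Str → Str → Bool) N →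
              (∀ u → length u ≡ a → f u ≡ true → #[ r ] (g u) ≡ N) →
              #[ a + r ] (λ w → f (take a w) ∧ g (take a w) (drop a w)) ≡ #[ a ] f * N
  #-product zero r f g N fibre rewrite #-zero f with f [] in f[]
  ... | true  = trans (fibre [] refl f[]) (sym (+-identityʳ N))
  ... | false = #-false r
  #-product (suc a) r f g N fibre = begin
    #[ suc (a + r) ] (λ w → f (take (suc a) w) ∧ g (take (suc a) w) (drop (suc a) w))
      ≡⟨ #-suc (a + r) _ ⟩
    ∑ (λ x → #[ a + r ] (λ w → f (x ∷ take a w) ∧ g (x ∷ take a w) (drop a w)))
      ≡⟨ sum-cong-≗ {k} (λ x → #-product a r (f ∘ (x ∷_)) (g ∘ (x ∷_)) N
                              (λ u len fu → fibre (x ∷ u) (cong suc len) fu)) ⟩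
    ∑ (λ x → #[ a ] (λ u → f (x ∷ u)) * N)
      ≡⟨ *-distribʳ-sum {k} N _ ⟨
    ∑ (λ x → #[ a ] (λ u → f (x ∷ u))) * N
      ≡⟨ cong (_* N) (#-suc a f) ⟨
    #[ suc a ] f * N
      ∎

  #-== : ∀ n v → length v ≡ n → #[ n ] (_== v) ≡ 1
  #-== zero    []      _   = trans (#-zero (_== [])) (cong (λ b → if b then 1 else 0) (≡⇒== {[]} refl))
  #-== (suc n) (y ∷ v) len = begin
    #[ suc n ] (_== (y ∷ v))                   ≡⟨ #-suc n _ ⟩
    ∑ (λ x → #[ n ] (λ w → (x ∷ w) == (y ∷ v))) ≡⟨ ∑-indicator y _ other ⟩
    #[ n ] (λ w → (y ∷ w) == (y ∷ v))           ≡⟨ #-cong n (λ w _ → ∷-== w) ⟩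
    #[ n ] (_== v)                              ≡⟨ #-== n v (cong pred len) ⟩
    1                                           ∎
    where
    ∷-== : ∀ w → (y ∷ w) == (y ∷ v) ≡ w == v
    ∷-== w = bool-ext (λ h → ≡⇒== (List.∷-injectiveʳ (==⇒≡ h))) (λ h → ≡⇒== (cong (y ∷_) (==⇒≡ h)))
    other : ∀ x → ¬ x ≡ y → #[ n ] (λ w → (x ∷ w) == (y ∷ v)) ≡ 0
    other x x≢y = trans (#-cong n (λ w _ → ≢⇒== (x≢y ∘ List.∷-injectiveˡ))) (#-false n)

  opaque
    unfolding #[_]_

    length≡# : ∀ n (l : List (Vec (Fin k) n)) (f : Str → Bool) → Unique l →
               (∀ w → w ∈ l ⇔ f (toList w) ≡ true) → length l ≡ #[ n ] f
    length≡# n l f l! l≗f = begin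
      length l              ≡⟨ count-∈ⱽ-Unique (words n) once l l! ⟨
      count (_∈ⱽ l) (words n) ≡⟨ count-cong (words n) (λ w → bool-ext
                                   (Equivalence.to (l≗f w) ∘ Equivalence.to ∈ⱽ⇔∈)
                                   (Equivalence.from ∈ⱽ⇔∈ ∘ Equivalence.from (l≗f w))) ⟩
      #[ n ] f              ∎
      where
      open BoolEquality {Vec (Fin k) n} (Vec.≡-dec Fin._≟_) using ()
        renaming (_==_ to _==ⱽ_; ==⇒≡ to ==ⱽ⇒≡; ≡⇒== to ≡⇒==ⱽ; _∈ᵇ_ to _∈ⱽ_; ∈ᵇ⇔∈ to ∈ⱽ⇔∈;
                  count-∈ᵇ-Unique to count-∈ⱽ-Unique)
      ==ⱽ-toList : ∀ v u → v ==ⱽ u ≡ toList v == toList u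
      ==ⱽ-toList v u = bool-ext
        (λ h → ≡⇒== (cong toList (==ⱽ⇒≡ h)))
        (λ h → ≡⇒==ⱽ (trans (sym (Vec.cast-is-id refl v)) (Vec.toList-injective refl v u (==⇒≡ h))))
      once : ∀ u → count (_==ⱽ u) (words n) ≡ 1
      once u = trans (count-cong (words n) (λ v → ==ⱽ-toList v u)) (#-== n (toList u) (Vec.length-toList u))

-- Words with prescribed palindromic prefixes

module PalPrefixCounting (k : ℕ) where

  open WordCounting k

  DependsOnPrefix : ℕ → (Str → Bool) → Set
  DependsOnPrefix a Q = ∀ w → a ≤ length w → Q w ≡ Q (take a w)

  length-take-+ : ∀ a r (w : Str) → length w ≡ a + r → length (take a w) ≡ a
  length-take-+ a r w len = length-take-≤ a w (≤-trans (m≤m+n a r) (≤-reflexive (sym len)))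

  length-drop-+ : ∀ a r (w : Str) → length w ≡ a + r → length (drop a w) ≡ r
  length-drop-+ a r w len = trans (List.length-drop a w) (trans (cong (_∸ a) len) (m+n∸m≡n a r))

  #-prefix-== : ∀ r d v → length v ≡ d → d ≤ r → #[ r ] (λ z → take d z == v) ≡ k ^ (r ∸ d)
  #-prefix-== r d v len d≤r = begin
    #[ r ] (λ z → take d z == v)                    ≡⟨ cong (λ n → #[ n ] (λ z → take d z == v)) (m+[n∸m]≡n d≤r) ⟨
    #[ d + (r ∸ d) ] (λ z → take d z == v)          ≡⟨ #-cong (d + (r ∸ d)) (λ w _ → sym (∧-identityʳ _)) ⟩
    #[ d + (r ∸ d) ] (λ z → (take d z == v) ∧ true) ≡⟨ #-product d (r ∸ d) (_== v) (λ _ _ → true) _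
                                                         (λ _ _ _ → #-true (r ∸ d)) ⟩
    #[ d ] (_== v) * k ^ (r ∸ d)                     ≡⟨ cong (_* k ^ (r ∸ d)) (#-== d v len) ⟩
    1 * k ^ (r ∸ d)                                 ≡⟨ *-identityˡ _ ⟩
    k ^ (r ∸ d)                                     ∎

  -- A palindrome of length 2h + q with q ≤ 1 is determined by its first h + q letters.
  #-isPal : ∀ h q → q ≤ 1 → #[ (h + q) + h ] isPal ≡ k ^ (h + q)
  #-isPal h q q≤1 = begin
    #[ a + h ] isPal                                            ≡⟨ #-cong (a + h) split ⟩
    #[ a + h ] (λ w → true ∧ (drop a w == reverse (take h (take a w))))
      ≡⟨ #-product a h (λ _ → true) (λ u z → z == reverse (take h u)) 1 mirror-once ⟩
    #[ a ] (λ _ → true) * 1                                     ≡⟨ *-identityʳ _ ⟩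
    #[ a ] (λ _ → true)                                         ≡⟨ #-true a ⟩
    k ^ a                                                       ∎
    where
    a = h + q
    h≤a : h ≤ a
    h≤a = m≤m+n h q
    mirror-once : ∀ u → length u ≡ a → true ≡ true → #[ h ] (_== reverse (take h u)) ≡ 1
    mirror-once u len _ = #-== h (reverse (take h u))
      (trans (List.length-reverse (take h u)) (length-take-≤ h u (≤-trans h≤a (≤-reflexive (sym len)))))
    split : ∀ w → length w ≡ a + h → isPal w ≡ true ∧ (drop a w == reverse (take h (take a w)))
    split w len =
      let u = take a w
          z = drop a w
          len-u = length-take-+ a h w len
          len-mid : length (drop h u) ≤ 1
          len-mid = ≤-trans (≤-reflexive (trans (List.length-drop h u) (trans (cong (_∸ h) len-u) (m+n∸m≡n h q)))) q≤1
      in begin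
        isPal w                                         ≡⟨ cong isPal (take++drop≡id a w) ⟨
        isPal (u ++ z)                                  ≡⟨ cong (λ x → isPal (x ++ z)) (take++drop≡id h u) ⟨
        isPal ((take h u ++ drop h u) ++ z)             ≡⟨ cong isPal (List.++-assoc (take h u) (drop h u) z) ⟩
        isPal (take h u ++ drop h u ++ z)               ≡⟨ isPal-++-++ (take h u) (drop h u) z
                                                             (trans (length-drop-+ a h w len)
                                                                    (sym (length-take-≤ h u (≤-trans h≤a (≤-reflexive (sym len-u)))))) ⟩
        (z == reverse (take h u)) ∧ isPal (drop h u)    ≡⟨ cong ((z == reverse (take h u)) ∧_) (isPal-short (drop h u) len-mid) ⟩
        (z == reverse (take h u)) ∧ true                ≡⟨ ∧-identityʳ _ ⟩
        z == reverse (take h u)                         ∎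

  #-palPrefix : ∀ b r → #[ b + r ] (palPrefix b) ≡ #[ b ] isPal * k ^ r
  #-palPrefix b r = begin
    #[ b + r ] (palPrefix b)                    ≡⟨ #-cong (b + r) (λ w len →
                                                     trans (palPrefix-≤ b w (≤-trans (m≤m+n b r) (≤-reflexive (sym len))))
                                                           (sym (∧-identityʳ _))) ⟩
    #[ b + r ] (λ w → isPal (take b w) ∧ true)  ≡⟨ #-product b r isPal (λ _ _ → true) (k ^ r) (λ _ _ _ → #-true r) ⟩
    #[ b ] isPal * k ^ r                        ∎

  -- If d ≤ a, palindromic prefixes of lengths a and a + d give the prefix of length a + d period d,
  -- so the prefix of length a - d is a palindrome and the d letters after position a are forced.
  #-palPrefix-overlap : ∀ a d r (Q : Str → Bool) → DependsOnPrefix a Q → d ≤ a → d ≤ r →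
    #[ a + r ] (λ w → palPrefix (a + d) w ∧ (palPrefix a w ∧ Q w)) * k ^ d ≡
    #[ a + r ] (λ w → palPrefix a w ∧ (palPrefix (a ∸ d) w ∧ Q w))
  #-palPrefix-overlap a d r Q Q-local d≤a d≤r = begin
    #[ a + r ] (λ w → palPrefix (a + d) w ∧ (palPrefix a w ∧ Q w)) * k ^ d
      ≡⟨ cong (_* k ^ d) (#-cong (a + r) split) ⟩
    #[ a + r ] (λ w → F (take a w) ∧ mirrored (take a w) (drop a w)) * k ^ d
      ≡⟨ cong (_* k ^ d) (#-product a r F mirrored (k ^ (r ∸ d)) mirrored-count) ⟩
    #[ a ] F * k ^ (r ∸ d) * k ^ d
      ≡⟨ *-assoc (#[ a ] F) (k ^ (r ∸ d)) (k ^ d) ⟩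
    #[ a ] F * (k ^ (r ∸ d) * k ^ d)
      ≡⟨ cong (#[ a ] F *_) (trans (sym (^-distribˡ-+-* k (r ∸ d) d)) (cong (k ^_) (m∸n+n≡m d≤r))) ⟩
    #[ a ] F * k ^ r
      ≡⟨ #-product a r F (λ _ _ → true) (k ^ r) (λ _ _ _ → #-true r) ⟨
    #[ a + r ] (λ w → F (take a w) ∧ true)
      ≡⟨ #-cong (a + r) unsplit ⟨
    #[ a + r ] (λ w → palPrefix a w ∧ (palPrefix (a ∸ d) w ∧ Q w))
      ∎
    where
    F : Str → Bool
    F u = isPal u ∧ (palPrefix (a ∸ d) u ∧ Q u)
    mirrored : Str → Str → Bool
    mirrored u z = take d z == reverse (take d u)
    mirrored-count : ∀ u → length u ≡ a → F u ≡ true → #[ r ] (mirrored u) ≡ k ^ (r ∸ d)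
    mirrored-count u len _ = #-prefix-== r d (reverse (take d u))
      (trans (List.length-reverse (take d u)) (length-take-≤ d u (≤-trans d≤a (≤-reflexive (sym len))))) d≤r
    shuffle : ∀ P X Y Z R → (P ≡ true → X ≡ R ∧ Y) → X ∧ (P ∧ Z) ≡ (P ∧ (Y ∧ Z)) ∧ R
    shuffle true  X Y Z R X≡ rewrite X≡ refl with R | Y | Z
    ... | true  | true  | true  = refl
    ... | true  | true  | false = refl
    ... | true  | false | _     = refl
    ... | false | true  | true  = refl
    ... | false | true  | false = refl
    ... | false | false | _     = refl
    shuffle false X Y Z R _ = ∧-zeroʳ X
    unsplit : ∀ w → length w ≡ a + r → palPrefix a w ∧ (palPrefix (a ∸ d) w ∧ Q w) ≡ F (take a w) ∧ true
    unsplit w len =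
      let a≤ = ≤-trans (m≤m+n a r) (≤-reflexive (sym len))
      in trans (cong₂ (λ x y → x ∧ (y ∧ Q w)) (palPrefix-≤ a w a≤) (palPrefix-take (a ∸ d) a w (m∸n≤m a d) a≤))
           (trans (cong (λ x → isPal (take a w) ∧ (palPrefix (a ∸ d) (take a w) ∧ x)) (Q-local w a≤))
             (sym (∧-identityʳ _)))
    split : ∀ w → length w ≡ a + r →
            palPrefix (a + d) w ∧ (palPrefix a w ∧ Q w) ≡ F (take a w) ∧ mirrored (take a w) (drop a w)
    split w len =
      let u = take a w
          t = take d (drop a w)
          a≤ = ≤-trans (m≤m+n a r) (≤-reflexive (sym len))
          len-u = length-take-+ a r w len
          len-t = length-take-≤ d (drop a w) (≤-trans d≤r (≤-reflexive (sym (length-drop-+ a r w len))))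
          extend : isPal u ≡ true → isPal (u ++ t) ≡ mirrored u (drop a w) ∧ palPrefix (a ∸ d) u
          extend u-pal = begin
            isPal (u ++ t)
              ≡⟨ isPal-extend u t d u-pal (≤-trans d≤a (≤-reflexive (sym len-u))) len-t ⟩
            mirrored u (drop a w) ∧ isPal (take (length u ∸ d) u)
              ≡⟨ cong (λ n → mirrored u (drop a w) ∧ isPal (take (n ∸ d) u)) len-u ⟩
            mirrored u (drop a w) ∧ isPal (take (a ∸ d) u)
              ≡⟨ cong (mirrored u (drop a w) ∧_) (palPrefix-≤ (a ∸ d) u (≤-trans (m∸n≤m a d) (≤-reflexive (sym len-u)))) ⟨
            mirrored u (drop a w) ∧ palPrefix (a ∸ d) u
              ∎
      in begin
        palPrefix (a + d) w ∧ (palPrefix a w ∧ Q w)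
          ≡⟨ cong₂ (λ x y → x ∧ (y ∧ Q w))
                   (trans (palPrefix-≤ (a + d) w (≤-trans (+-monoʳ-≤ a d≤r) (≤-reflexive (sym len))))
                          (cong isPal (take-+ a d w)))
                   (palPrefix-≤ a w a≤) ⟩
        isPal (u ++ t) ∧ (isPal u ∧ Q w)
          ≡⟨ cong (λ x → isPal (u ++ t) ∧ (isPal u ∧ x)) (Q-local w a≤) ⟩
        isPal (u ++ t) ∧ (isPal u ∧ Q u)
          ≡⟨ shuffle (isPal u) (isPal (u ++ t)) (palPrefix (a ∸ d) u) (Q u) (mirrored u (drop a w)) extend ⟩
        F u ∧ mirrored u (drop a w)
          ∎

  -- A word u y z with |u| = |z| = a and |y| = e is a palindrome iff z is the reversal of u and y is
  -- a palindrome.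
  #-palPrefix-gap : ∀ a e r h (Q : Str → Bool) → DependsOnPrefix a Q → e + a ≤ r → #[ e ] isPal ≡ k ^ h →
    #[ a + r ] (λ w → palPrefix (a + (e + a)) w ∧ (palPrefix a w ∧ Q w)) * k ^ (e + a) ≡
    #[ a + r ] (λ w → palPrefix a w ∧ Q w) * k ^ h
  #-palPrefix-gap a e r h Q Q-local ea≤r #pal = begin
    #[ a + r ] (λ w → palPrefix (a + (e + a)) w ∧ (palPrefix a w ∧ Q w)) * k ^ (e + a)
      ≡⟨ cong (_* k ^ (e + a)) (#-cong (a + r) split) ⟩
    #[ a + r ] (λ w → F (take a w) ∧ closed (take a w) (drop a w)) * k ^ (e + a)
      ≡⟨ cong (_* k ^ (e + a)) (#-product a r F closed (k ^ h * k ^ ((r ∸ e) ∸ a)) closed-count) ⟩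
    #[ a ] F * (k ^ h * k ^ ((r ∸ e) ∸ a)) * k ^ (e + a)
      ≡⟨ solve 4 (λ X H Y Z → X :* (H :* Y) :* Z := X :* (Y :* Z) :* H) refl (#[ a ] F) (k ^ h) _ _ ⟩
    #[ a ] F * (k ^ ((r ∸ e) ∸ a) * k ^ (e + a)) * k ^ h
      ≡⟨ cong (λ x → #[ a ] F * x * k ^ h) (trans (sym (^-distribˡ-+-* k ((r ∸ e) ∸ a) (e + a)))
           (cong (k ^_) (trans (cong (_+ (e + a)) (∸-+-assoc r e a)) (m∸n+n≡m ea≤r)))) ⟩
    #[ a ] F * k ^ r * k ^ h
      ≡⟨ cong (_* k ^ h) (#-product a r F (λ _ _ → true) (k ^ r) (λ _ _ _ → #-true r)) ⟨
    #[ a + r ] (λ w → F (take a w) ∧ true) * k ^ h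
      ≡⟨ cong (_* k ^ h) (#-cong (a + r) unsplit) ⟨
    #[ a + r ] (λ w → palPrefix a w ∧ Q w) * k ^ h
      ∎
    where
    F : Str → Bool
    F u = isPal u ∧ Q u
    closed : Str → Str → Bool
    closed u z = isPal (take e z) ∧ (take a (drop e z) == reverse u)
    e≤r : e ≤ r
    e≤r = ≤-trans (m≤m+n e a) ea≤r
    a≤r∸e : a ≤ r ∸ e
    a≤r∸e = ≤-trans (≤-reflexive (sym (m+n∸m≡n e a))) (∸-monoˡ-≤ e ea≤r)
    closed-count : ∀ u → length u ≡ a → F u ≡ true → #[ r ] (closed u) ≡ k ^ h * k ^ ((r ∸ e) ∸ a)
    closed-count u len _ = begin
      #[ r ] (closed u)              ≡⟨ cong (λ n → #[ n ] (closed u)) (m+[n∸m]≡n e≤r) ⟨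
      #[ e + (r ∸ e) ] (closed u)    ≡⟨ #-product e (r ∸ e) isPal (λ _ z → take a z == reverse u) (k ^ ((r ∸ e) ∸ a))
                                          (λ _ _ _ → #-prefix-== (r ∸ e) a (reverse u) (trans (List.length-reverse u) len) a≤r∸e) ⟩
      #[ e ] isPal * k ^ ((r ∸ e) ∸ a) ≡⟨ cong (_* k ^ ((r ∸ e) ∸ a)) #pal ⟩
      k ^ h * k ^ ((r ∸ e) ∸ a)       ∎
    unsplit : ∀ w → length w ≡ a + r → palPrefix a w ∧ Q w ≡ F (take a w) ∧ true
    unsplit w len =
      let a≤ = ≤-trans (m≤m+n a r) (≤-reflexive (sym len))
      in trans (cong₂ _∧_ (palPrefix-≤ a w a≤) (Q-local w a≤)) (sym (∧-identityʳ _))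
    split : ∀ w → length w ≡ a + r →
            palPrefix (a + (e + a)) w ∧ (palPrefix a w ∧ Q w) ≡ F (take a w) ∧ closed (take a w) (drop a w)
    split w len =
      let u = take a w
          z = drop a w
          a≤ = ≤-trans (m≤m+n a r) (≤-reflexive (sym len))
          len-mirror : length (take a (drop e z)) ≡ length u
          len-mirror = trans (length-take-≤ a (drop e z)
                               (≤-trans a≤r∸e (≤-reflexive (trans (cong (_∸ e) (sym (length-drop-+ a r w len)))
                                                                  (sym (List.length-drop e z))))))
                             (sym (length-take-+ a r w len))
      in begin
        palPrefix (a + (e + a)) w ∧ (palPrefix a w ∧ Q w)
          ≡⟨ cong₂ (λ x y → x ∧ (y ∧ Q w))
                   (trans (palPrefix-≤ _ w (≤-trans (+-monoʳ-≤ a ea≤r) (≤-reflexive (sym len))))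
                          (cong isPal (trans (take-+ a (e + a) w) (cong (u ++_) (take-+ e a z)))))
                   (palPrefix-≤ a w a≤) ⟩
        isPal (u ++ take e z ++ take a (drop e z)) ∧ (isPal u ∧ Q w)
          ≡⟨ cong₂ (λ x y → x ∧ (isPal u ∧ y)) (isPal-++-++ u (take e z) (take a (drop e z)) len-mirror) (Q-local w a≤) ⟩
        ((take a (drop e z) == reverse u) ∧ isPal (take e z)) ∧ (isPal u ∧ Q u)
          ≡⟨ shuffle (isPal u) (isPal (take e z)) (Q u) (take a (drop e z) == reverse u) ⟩
        F u ∧ closed u z
          ∎
      where
      shuffle : ∀ P Y Z R → (R ∧ Y) ∧ (P ∧ Z) ≡ (P ∧ Z) ∧ (Y ∧ R)
      shuffle P Y Z true  = trans (∧-comm Y (P ∧ Z)) (cong ((P ∧ Z) ∧_) (sym (∧-identityʳ Y)))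
      shuffle P Y Z false = sym (trans (cong ((P ∧ Z) ∧_) (∧-zeroʳ Y)) (∧-zeroʳ (P ∧ Z)))

module OrderReduction (k : ℕ) where

  open WordCounting k
  open PalPrefixCounting k

  -- p = 0 gives the even palindromic prefix of order i, p = 1 the odd one.
  palLength : ℕ → ℕ → ℕ
  palLength p i = p + (i + i)

  palLength-mono : ∀ p {i j} → i ≤ j → palLength p i ≤ palLength p j
  palLength-mono p i≤j = +-monoʳ-≤ p (+-mono-≤ i≤j i≤j)

  #-palPrefix-order : ∀ p n t → p ≤ 1 → palLength p t ≤ n → #[ n ] (palPrefix (palLength p t)) ≡ k ^ (n ∸ t)
  #-palPrefix-order p n t p≤1 ℓ≤n with m≤n⇒∃[o]m+o≡n ℓ≤n
  ... | x , refl = begin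
    #[ palLength p t + x ] (palPrefix (palLength p t))  ≡⟨ #-palPrefix (palLength p t) x ⟩
    #[ palLength p t ] isPal * k ^ x                    ≡⟨ cong (λ n → #[ n ] isPal * k ^ x) ℓ≡ ⟩
    #[ (t + p) + t ] isPal * k ^ x                      ≡⟨ cong (_* k ^ x) (#-isPal t p p≤1) ⟩
    k ^ (t + p) * k ^ x                                 ≡⟨ ^-distribˡ-+-* k (t + p) x ⟨
    k ^ ((t + p) + x)                                   ≡⟨ cong (k ^_) (m+n∸m≡n t ((t + p) + x)) ⟨
    k ^ ((t + ((t + p) + x)) ∸ t)                       ≡⟨ cong (λ n → k ^ (n ∸ t)) n≡ ⟨
    k ^ ((palLength p t + x) ∸ t)                       ∎
    where
    ℓ≡ : palLength p t ≡ (t + p) + t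
    ℓ≡ = solve 2 (λ p t → p :+ (t :+ t) := (t :+ p) :+ t) refl p t
    n≡ : palLength p t + x ≡ t + ((t + p) + x)
    n≡ = solve 3 (λ p t x → (p :+ (t :+ t)) :+ x := t :+ ((t :+ p) :+ x)) refl p t x

  #-palPrefix-near : ∀ p n s t (Q : Str → Bool) → DependsOnPrefix (palLength p s) Q →
    s ≤ t → t ≤ s + s → palLength p t ≤ n →
    #[ n ] (λ w → palPrefix (palLength p t) w ∧ (palPrefix (palLength p s) w ∧ Q w)) * k ^ ((t ∸ s) + (t ∸ s)) ≡
    #[ n ] (λ w → palPrefix (palLength p s) w ∧ (palPrefix (palLength p ((s + s) ∸ t)) w ∧ Q w))
  -- With t = s + j and s = j + i this is #-palPrefix-overlap for a = ℓ_p(s) and d = 2j.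
  #-palPrefix-near p n s t Q Q-local s≤t t≤2s ℓ≤n with m≤n⇒∃[o]m+o≡n s≤t
  ... | j , refl with m≤n⇒∃[o]m+o≡n (+-cancelˡ-≤ s j s t≤2s)
  ... | i , refl = begin
    #[ n ] (λ w → palPrefix (palLength p t) w ∧ (palPrefix a w ∧ Q w)) * k ^ ((t ∸ s) + (t ∸ s))
      ≡⟨ cong₂ (λ ℓ m → #[ n ] (λ w → palPrefix ℓ w ∧ (palPrefix a w ∧ Q w)) * k ^ (m + m)) ℓt≡ (m+n∸m≡n s j) ⟩
    #[ n ] (λ w → palPrefix (a + d) w ∧ (palPrefix a w ∧ Q w)) * k ^ d
      ≡⟨ cong (λ m → #[ m ] (λ w → palPrefix (a + d) w ∧ (palPrefix a w ∧ Q w)) * k ^ d) (m+[n∸m]≡n a≤n) ⟨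
    #[ a + (n ∸ a) ] (λ w → palPrefix (a + d) w ∧ (palPrefix a w ∧ Q w)) * k ^ d
      ≡⟨ #-palPrefix-overlap a d (n ∸ a) Q Q-local d≤a d≤n∸a ⟩
    #[ a + (n ∸ a) ] (λ w → palPrefix a w ∧ (palPrefix (a ∸ d) w ∧ Q w))
      ≡⟨ cong₂ (λ m ℓ → #[ m ] (λ w → palPrefix a w ∧ (palPrefix ℓ w ∧ Q w))) (m+[n∸m]≡n a≤n) a∸d≡ ⟩
    #[ n ] (λ w → palPrefix a w ∧ (palPrefix (palLength p ((s + s) ∸ t)) w ∧ Q w))
      ∎
    where
    a = palLength p s
    d = j + j
    ℓt≡ : palLength p t ≡ a + d
    ℓt≡ = solve 3 (λ p i j → p :+ (((j :+ i) :+ j) :+ ((j :+ i) :+ j)) := (p :+ ((j :+ i) :+ (j :+ i))) :+ (j :+ j)) refl p i j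
    a≡ : a ≡ d + palLength p i
    a≡ = solve 3 (λ p i j → p :+ ((j :+ i) :+ (j :+ i)) := (j :+ j) :+ (p :+ (i :+ i))) refl p i j
    2s∸t≡ : (s + s) ∸ t ≡ i
    2s∸t≡ = trans (cong (_∸ t) (solve 2 (λ i j → (j :+ i) :+ (j :+ i) := ((j :+ i) :+ j) :+ i) refl i j)) (m+n∸m≡n t i)
    a∸d≡ : a ∸ d ≡ palLength p ((s + s) ∸ t)
    a∸d≡ = trans (cong (_∸ d) a≡) (trans (m+n∸m≡n d (palLength p i)) (cong (palLength p) (sym 2s∸t≡)))
    d≤a : d ≤ a
    d≤a = ≤-trans (m≤m+n d (palLength p i)) (≤-reflexive (sym a≡))
    a+d≤n : a + d ≤ n
    a+d≤n = ≤-trans (≤-reflexive (sym ℓt≡)) ℓ≤n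
    a≤n : a ≤ n
    a≤n = ≤-trans (m≤m+n a d) a+d≤n
    d≤n∸a : d ≤ n ∸ a
    d≤n∸a = ≤-trans (≤-reflexive (sym (m+n∸m≡n a d))) (∸-monoˡ-≤ a a+d≤n)

  #-palPrefix-far : ∀ p n s t (Q : Str → Bool) → p ≤ 1 → DependsOnPrefix (palLength p s) Q →
    s + s < t → palLength p t ≤ n →
    #[ n ] (λ w → palPrefix (palLength p t) w ∧ (palPrefix (palLength p s) w ∧ Q w)) * k ^ ((t ∸ s) + (t ∸ s)) ≡
    #[ n ] (λ w → palPrefix (palLength p s) w ∧ Q w) * k ^ (t ∸ (s + s))
  -- With t = 2s + p + h this is #-palPrefix-gap for a = ℓ_p(s) and e = 2h + p.
  #-palPrefix-far p n s t Q p≤1 Q-local 2s<t ℓ≤n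
    with m≤n⇒∃[o]m+o≡n (≤-trans (+-monoʳ-≤ (s + s) p≤1) (≤-trans (≤-reflexive (+-comm (s + s) 1)) 2s<t))
  ... | h , refl = begin
    #[ n ] (λ w → palPrefix (palLength p t) w ∧ (palPrefix a w ∧ Q w)) * k ^ ((t ∸ s) + (t ∸ s))
      ≡⟨ cong₂ (λ ℓ m → #[ n ] (λ w → palPrefix ℓ w ∧ (palPrefix a w ∧ Q w)) * k ^ m) ℓt≡ t∸s≡ ⟩
    #[ n ] (λ w → palPrefix (a + (e + a)) w ∧ (palPrefix a w ∧ Q w)) * k ^ (e + a)
      ≡⟨ cong (λ m → #[ m ] (λ w → palPrefix (a + (e + a)) w ∧ (palPrefix a w ∧ Q w)) * k ^ (e + a)) (m+[n∸m]≡n a≤n) ⟨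
    #[ a + (n ∸ a) ] (λ w → palPrefix (a + (e + a)) w ∧ (palPrefix a w ∧ Q w)) * k ^ (e + a)
      ≡⟨ #-palPrefix-gap a e (n ∸ a) (h + p) Q Q-local e+a≤n∸a (#-isPal h p p≤1) ⟩
    #[ a + (n ∸ a) ] (λ w → palPrefix a w ∧ Q w) * k ^ (h + p)
      ≡⟨ cong₂ (λ m x → #[ m ] (λ w → palPrefix a w ∧ Q w) * k ^ x) (m+[n∸m]≡n a≤n) t∸2s≡ ⟩
    #[ n ] (λ w → palPrefix a w ∧ Q w) * k ^ (t ∸ (s + s))
      ∎
    where
    a = palLength p s
    e = (h + p) + h
    ℓt≡ : palLength p t ≡ a + (e + a)
    ℓt≡ = solve 3 (λ p s h → p :+ ((((s :+ s) :+ p) :+ h) :+ (((s :+ s) :+ p) :+ h))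
                          := (p :+ (s :+ s)) :+ (((h :+ p) :+ h) :+ (p :+ (s :+ s)))) refl p s h
    t∸s≡ : (t ∸ s) + (t ∸ s) ≡ e + a
    t∸s≡ = trans (cong (λ x → x + x) (trans (cong (_∸ s) (solve 3 (λ p s h → ((s :+ s) :+ p) :+ h := s :+ (s :+ (h :+ p))) refl p s h))
                                             (m+n∸m≡n s (s + (h + p)))))
                 (solve 3 (λ p s h → (s :+ (h :+ p)) :+ (s :+ (h :+ p)) := ((h :+ p) :+ h) :+ (p :+ (s :+ s))) refl p s h)
    t∸2s≡ : h + p ≡ t ∸ (s + s)
    t∸2s≡ = sym (trans (cong (_∸ (s + s)) (+-assoc (s + s) p h)) (trans (m+n∸m≡n (s + s) (p + h)) (+-comm p h)))
    a+e+a≤n : a + (e + a) ≤ n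
    a+e+a≤n = ≤-trans (≤-reflexive (sym ℓt≡)) ℓ≤n
    a≤n : a ≤ n
    a≤n = ≤-trans (m≤m+n a (e + a)) a+e+a≤n
    e+a≤n∸a : e + a ≤ n ∸ a
    e+a≤n∸a = ≤-trans (≤-reflexive (sym (m+n∸m≡n a (e + a)))) (∸-monoˡ-≤ a a+e+a≤n)

-- Independence of the parity

module ParityInvariance (k : ℕ) where

  open WordCounting k
  open PalPrefixCounting k
  open OrderReduction k

  max-∈ : ∀ x xs → max x xs ∈ x ∷ xs
  max-∈ x xs = argmax-all (λ i → i) {P = _∈ x ∷ xs} (here refl) (All.tabulate there)

  ≤-max : ∀ x xs → All (_≤ max x xs) (x ∷ xs)
  ≤-max x xs = ⊥≤max x xs ∷ xs≤max x xs

  allPalPrefixes : ℕ → List ℕ → Str → Bool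
  allPalPrefixes p []      w = true
  allPalPrefixes p (i ∷ I) w = palPrefix (palLength p i) w ∧ allPalPrefixes p I w

  allPalPrefixes-true : ∀ p I w →
    allPalPrefixes p I w ≡ true ⇔ All (λ i → palPrefix (palLength p i) w ≡ true) I
  allPalPrefixes-true p I w = mk⇔ (to I) (from I)
    where
    to : ∀ I → allPalPrefixes p I w ≡ true → All (λ i → palPrefix (palLength p i) w ≡ true) I
    to []      _ = []
    to (i ∷ I) h = let (hi , hI) = ∧≡true⇒ h in hi ∷ to I hI
    from : ∀ I → All (λ i → palPrefix (palLength p i) w ≡ true) I → allPalPrefixes p I w ≡ true
    from []      []         = refl
    from (i ∷ I) (hi ∷ hI) = cong₂ _∧_ hi (from I hI)

  allPalPrefixes-local : ∀ p s I → All (_≤ s) I → DependsOnPrefix (palLength p s) (allPalPrefixes p I)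
  allPalPrefixes-local p s []      _            w _ = refl
  allPalPrefixes-local p s (i ∷ I) (i≤s ∷ I≤s) w ℓ≤ =
    cong₂ _∧_ (palPrefix-take (palLength p i) (palLength p s) w (palLength-mono p i≤s) ℓ≤)
              (allPalPrefixes-local p s I I≤s w ℓ≤)

  below : ℕ → List ℕ → List ℕ
  below s = filter (_<? s)

  allPalPrefixes-max : ∀ p s I w → s ∈ I → All (_≤ s) I →
    allPalPrefixes p I w ≡ palPrefix (palLength p s) w ∧ allPalPrefixes p (below s I) w
  allPalPrefixes-max p s I w s∈I I≤s = bool-ext
    (λ h → let all = Equivalence.to (allPalPrefixes-true p I w) h in
       cong₂ _∧_ (All.lookup all s∈I) (Equivalence.from (allPalPrefixes-true p _ w) (filter⁺ (_<? s) all)))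
    (λ h → let (hs , hbelow) = ∧≡true⇒ h in
       Equivalence.from (allPalPrefixes-true p I w)
         (filter⁻ (_<? s) (Equivalence.to (allPalPrefixes-true p _ w) hbelow)
           (All.tabulate λ i∈ → let (i∈I , i≮s) = ∈-filter⁻ (¬? ∘ (_<? s)) {xs = I} i∈ in
              subst (λ i → palPrefix (palLength p i) w ≡ true)
                    (≤-antisym (≮⇒≥ i≮s) (All.lookup I≤s i∈I)) hs)))

  module _ (n t s : ℕ) (R : List ℕ) (s∈R : s ∈ R) (R≤s : All (_≤ s) R) (s<t : s < t) where

    private
      Q : ℕ → Str → Bool
      Q p = allPalPrefixes p (below s R)

      Q-local : ∀ p → DependsOnPrefix (palLength p s) (Q p)
      Q-local p = allPalPrefixes-local p s (below s R) (All.map <⇒≤ (all-filter (_<? s) R))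

      split : ∀ p → #[ n ] (allPalPrefixes p (t ∷ R)) ≡
                    #[ n ] (λ w → palPrefix (palLength p t) w ∧ (palPrefix (palLength p s) w ∧ Q p w))
      split p = #-cong n (λ w _ → cong (palPrefix (palLength p t) w ∧_) (allPalPrefixes-max p s R w s∈R R≤s))

    #-allPalPrefixes-near : ∀ p → palLength p t ≤ n → t ≤ s + s →
      #[ n ] (allPalPrefixes p (t ∷ R)) * k ^ ((t ∸ s) + (t ∸ s)) ≡
      #[ n ] (allPalPrefixes p (s ∷ ((s + s) ∸ t) ∷ below s R))
    #-allPalPrefixes-near p ℓ≤n t≤2s =
      trans (cong (_* k ^ ((t ∸ s) + (t ∸ s))) (split p))
            (#-palPrefix-near p n s t (Q p) (Q-local p) (<⇒≤ s<t) t≤2s ℓ≤n)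

    #-allPalPrefixes-far : ∀ p → p ≤ 1 → palLength p t ≤ n → s + s < t →
      #[ n ] (allPalPrefixes p (t ∷ R)) * k ^ ((t ∸ s) + (t ∸ s)) ≡
      #[ n ] (allPalPrefixes p (s ∷ below s R)) * k ^ (t ∸ (s + s))
    #-allPalPrefixes-far p p≤1 ℓ≤n 2s<t =
      trans (cong (_* k ^ ((t ∸ s) + (t ∸ s))) (split p))
            (#-palPrefix-far p n s t (Q p) p≤1 (Q-local p) 2s<t ℓ≤n)

  -- Induction on an upper bound B for the largest order t: each step replaces t by the next
  -- largest order s, multiplying both counts by the same power of k.
  #-allPalPrefixes-parity-∷ : ∀ {{_ : NonZero k}} n B t R → t < B → All (_< t) R → palLength 1 t ≤ n →
    #[ n ] (allPalPrefixes 0 (t ∷ R)) ≡ #[ n ] (allPalPrefixes 1 (t ∷ R))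
  #-allPalPrefixes-parity-∷ n (suc B) t [] _ _ ℓ≤n = begin
    #[ n ] (allPalPrefixes 0 (t ∷ []))     ≡⟨ #-cong n (λ w _ → ∧-identityʳ _) ⟩
    #[ n ] (palPrefix (palLength 0 t))    ≡⟨ #-palPrefix-order 0 n t z≤n (≤-trans (n≤1+n _) ℓ≤n) ⟩
    k ^ (n ∸ t)                           ≡⟨ #-palPrefix-order 1 n t ≤-refl ℓ≤n ⟨
    #[ n ] (palPrefix (palLength 1 t))    ≡⟨ #-cong n (λ w _ → ∧-identityʳ _) ⟨
    #[ n ] (allPalPrefixes 1 (t ∷ []))     ∎
  #-allPalPrefixes-parity-∷ n (suc B) t R@(x ∷ R′) (s≤s t≤B) R<t ℓ≤n =
    Step.by-cases (max x R′) (max-∈ x R′) (≤-max x R′)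
    where
    module Step (s : ℕ) (s∈R : s ∈ R) (R≤s : All (_≤ s) R) where
      s<t : s < t
      s<t = All.lookup R<t s∈R
      s<B : s < B
      s<B = <-≤-trans s<t t≤B
      R₀ = below s R
      R₀<s : All (_< s) R₀
      R₀<s = all-filter (_<? s) R
      D = (t ∸ s) + (t ∸ s)
      ℓs≤n : palLength 1 s ≤ n
      ℓs≤n = ≤-trans (palLength-mono 1 (<⇒≤ s<t)) ℓ≤n
      near = #-allPalPrefixes-near n t s R s∈R R≤s s<t
      far = #-allPalPrefixes-far n t s R s∈R R≤s s<t

      near-case : t ≤ s + s → #[ n ] (allPalPrefixes 0 (t ∷ R)) ≡ #[ n ] (allPalPrefixes 1 (t ∷ R))
      near-case t≤2s = *-cancelʳ-≡ _ _ (k ^ D) {{m^n≢0 k D}} (begin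
        #[ n ] (allPalPrefixes 0 (t ∷ R)) * k ^ D         ≡⟨ near 0 (≤-trans (n≤1+n _) ℓ≤n) t≤2s ⟩
        #[ n ] (allPalPrefixes 0 (s ∷ (s + s) ∸ t ∷ R₀))  ≡⟨ #-allPalPrefixes-parity-∷ n B s ((s + s) ∸ t ∷ R₀) s<B
                                                               (2s∸t<s ∷ R₀<s) ℓs≤n ⟩
        #[ n ] (allPalPrefixes 1 (s ∷ (s + s) ∸ t ∷ R₀))  ≡⟨ near 1 ℓ≤n t≤2s ⟨
        #[ n ] (allPalPrefixes 1 (t ∷ R)) * k ^ D         ∎)
        where
        2s∸t<s : (s + s) ∸ t < s
        2s∸t<s = subst ((s + s) ∸ t <_) (m+n∸m≡n s s) (∸-monoʳ-< s<t t≤2s)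

      far-case : s + s < t → #[ n ] (allPalPrefixes 0 (t ∷ R)) ≡ #[ n ] (allPalPrefixes 1 (t ∷ R))
      far-case 2s<t = *-cancelʳ-≡ _ _ (k ^ D) {{m^n≢0 k D}} (begin
        #[ n ] (allPalPrefixes 0 (t ∷ R)) * k ^ D               ≡⟨ far 0 z≤n (≤-trans (n≤1+n _) ℓ≤n) 2s<t ⟩
        #[ n ] (allPalPrefixes 0 (s ∷ R₀)) * k ^ (t ∸ (s + s))  ≡⟨ cong (_* k ^ (t ∸ (s + s)))
                                                                     (#-allPalPrefixes-parity-∷ n B s R₀ s<B R₀<s ℓs≤n) ⟩
        #[ n ] (allPalPrefixes 1 (s ∷ R₀)) * k ^ (t ∸ (s + s))  ≡⟨ far 1 ≤-refl ℓ≤n 2s<t ⟨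
        #[ n ] (allPalPrefixes 1 (t ∷ R)) * k ^ D               ∎)

      by-cases : #[ n ] (allPalPrefixes 0 (t ∷ R)) ≡ #[ n ] (allPalPrefixes 1 (t ∷ R))
      by-cases with t ≤? s + s
      ... | yes t≤2s = near-case t≤2s
      ... | no t≰2s  = far-case (≰⇒> t≰2s)

module Profiles (k : ℕ) where

  open WordCounting k
  open OrderReduction k
  open ParityInvariance k

  #-allPalPrefixes-parity : ∀ {{_ : NonZero k}} n T → All (λ i → palLength 1 i ≤ n) T →
    #[ n ] (allPalPrefixes 0 T) ≡ #[ n ] (allPalPrefixes 1 T)
  #-allPalPrefixes-parity n []      _   = refl
  #-allPalPrefixes-parity n T@(x ∷ T′) T≤n = begin
    #[ n ] (allPalPrefixes 0 T)             ≡⟨ #-cong n (λ w _ → allPalPrefixes-max 0 t T w t∈T T≤t) ⟩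
    #[ n ] (allPalPrefixes 0 (t ∷ below t T)) ≡⟨ #-allPalPrefixes-parity-∷ n (suc t) t (below t T) ≤-refl
                                                  (all-filter (_<? t) T) (All.lookup T≤n t∈T) ⟩
    #[ n ] (allPalPrefixes 1 (t ∷ below t T)) ≡⟨ #-cong n (λ w _ → allPalPrefixes-max 1 t T w t∈T T≤t) ⟨
    #[ n ] (allPalPrefixes 1 T)             ∎
    where
    t = max x T′
    t∈T : t ∈ T
    t∈T = max-∈ x T′
    T≤t : All (_≤ t) T
    T≤t = ≤-max x T′

  profile : ℕ → (ℕ → Bool) → List ℕ → Str → Bool
  profile p σ []      w = true
  profile p σ (i ∷ I) w = (if σ i then palPrefix (palLength p i) w else not (palPrefix (palLength p i) w))
                          ∧ profile p σ I w

  private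
    ∧-exchange : ∀ a b c → a ∧ (b ∧ c) ≡ (b ∧ a) ∧ c
    ∧-exchange true  b c = sym (cong (_∧ c) (∧-identityʳ b))
    ∧-exchange false b c = sym (cong (_∧ c) (∧-zeroʳ b))

    ∧-rotate : ∀ a b c → (a ∧ c) ∧ b ≡ (b ∧ a) ∧ c
    ∧-rotate true  true  c = ∧-identityʳ c
    ∧-rotate true  false c = ∧-zeroʳ c
    ∧-rotate false true  c = refl
    ∧-rotate false false c = refl

    ∧-exchange-not : ∀ a b c → (a ∧ c) ∧ not b ≡ a ∧ (not b ∧ c)
    ∧-exchange-not true  b c = ∧-comm c (not b)
    ∧-exchange-not false b c = refl

  -- Inclusion–exclusion: a forbidden order i is "allowed" minus "required".
  #-profile-parity : ∀ {{_ : NonZero k}} n σ S I →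
    All (λ i → palLength 1 i ≤ n) S → All (λ i → palLength 1 i ≤ n) I →
    #[ n ] (λ w → allPalPrefixes 0 S w ∧ profile 0 σ I w) ≡ #[ n ] (λ w → allPalPrefixes 1 S w ∧ profile 1 σ I w)
  #-profile-parity n σ S [] S≤n _ = begin
    #[ n ] (λ w → allPalPrefixes 0 S w ∧ true) ≡⟨ #-cong n (λ w _ → ∧-identityʳ _) ⟩
    #[ n ] (allPalPrefixes 0 S)                ≡⟨ #-allPalPrefixes-parity n S S≤n ⟩
    #[ n ] (allPalPrefixes 1 S)                ≡⟨ #-cong n (λ w _ → ∧-identityʳ _) ⟨
    #[ n ] (λ w → allPalPrefixes 1 S w ∧ true) ∎
  #-profile-parity n σ S (i ∷ I) S≤n (i≤n ∷ I≤n) with σ i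
  ... | true = begin
    #[ n ] (λ w → allPalPrefixes 0 S w ∧ (palPrefix (palLength 0 i) w ∧ profile 0 σ I w))
      ≡⟨ #-cong n (λ w _ → ∧-exchange (allPalPrefixes 0 S w) (palPrefix (palLength 0 i) w) (profile 0 σ I w)) ⟩
    #[ n ] (λ w → allPalPrefixes 0 (i ∷ S) w ∧ profile 0 σ I w)
      ≡⟨ #-profile-parity n σ (i ∷ S) I (i≤n ∷ S≤n) I≤n ⟩
    #[ n ] (λ w → allPalPrefixes 1 (i ∷ S) w ∧ profile 1 σ I w)
      ≡⟨ #-cong n (λ w _ → ∧-exchange (allPalPrefixes 1 S w) (palPrefix (palLength 1 i) w) (profile 1 σ I w)) ⟨
    #[ n ] (λ w → allPalPrefixes 1 S w ∧ (palPrefix (palLength 1 i) w ∧ profile 1 σ I w))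
      ∎
  ... | false = +-cancelˡ-≡ (#[ n ] (with-i 0)) _ _ (begin
    #[ n ] (with-i 0) + #[ n ] (without-i 0) ≡⟨ split 0 ⟨
    #[ n ] (λ w → allPalPrefixes 0 S w ∧ profile 0 σ I w)
      ≡⟨ #-profile-parity n σ S I S≤n I≤n ⟩
    #[ n ] (λ w → allPalPrefixes 1 S w ∧ profile 1 σ I w)
      ≡⟨ split 1 ⟩
    #[ n ] (with-i 1) + #[ n ] (without-i 1)
      ≡⟨ cong (_+ #[ n ] (without-i 1)) (#-profile-parity n σ (i ∷ S) I (i≤n ∷ S≤n) I≤n) ⟨
    #[ n ] (with-i 0) + #[ n ] (without-i 1) ∎)
    where
    with-i without-i : ℕ → Str → Bool
    with-i p w = allPalPrefixes p (i ∷ S) w ∧ profile p σ I w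
    without-i p w = allPalPrefixes p S w ∧ (not (palPrefix (palLength p i) w) ∧ profile p σ I w)
    split : ∀ p → #[ n ] (λ w → allPalPrefixes p S w ∧ profile p σ I w) ≡
                  #[ n ] (with-i p) + #[ n ] (without-i p)
    split p = trans (#-split n _ (palPrefix (palLength p i))) (cong₂ _+_
      (#-cong n λ w _ → ∧-rotate (allPalPrefixes p S w) (palPrefix (palLength p i) w) (profile p σ I w))
      (#-cong n λ w _ → ∧-exchange-not (allPalPrefixes p S w) (palPrefix (palLength p i) w) (profile p σ I w)))

toList-take : ∀ {A : Set} m {r} (v : Vec A (m + r)) → toList (Vec.take m v) ≡ take m (toList v)
toList-take zero    v          = refl
toList-take (suc m) (x Vec.∷ v) = cong (x ∷_) (toList-take m v)

-- Exact sets of orders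

module ExactOrders (k : ℕ) where

  open WordCounting k
  open PalPrefixCounting k
  open OrderReduction k
  open ParityInvariance k
  open Profiles k

  PalPrefix⇔palPrefix : ∀ {n} (w : Word k n) L → PalPrefix w L ⇔ palPrefix L (toList w) ≡ true
  PalPrefix⇔palPrefix {n} w L = mk⇔ to from
    where
    toList-prefix : ∀ {r} (eq : n ≡ L + r) → toList (Vec.take L (Vec.cast eq w)) ≡ take L (toList w)
    toList-prefix eq = trans (toList-take L (Vec.cast eq w)) (cong (take L) (Vec.toList-cast eq w))
    to : PalPrefix w L → palPrefix L (toList w) ≡ true
    to (r , eq , pal) = trans (palPrefix-≤ L (toList w) L≤) (⇒isPal _ (begin
        reverse (take L (toList w))            ≡⟨ cong reverse (toList-prefix eq) ⟨
        reverse (toList v)                     ≡⟨ Vec.toList-reverse v ⟨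
        toList (Vec.reverse v)                 ≡⟨ cong toList pal ⟩
        toList v                               ≡⟨ toList-prefix eq ⟩
        take L (toList w)                      ∎))
      where
      v = Vec.take L (Vec.cast eq w)
      L≤ : L ≤ length (toList w)
      L≤ = ≤-trans (m≤m+n L r) (≤-reflexive (trans (sym eq) (sym (Vec.length-toList w))))
    from : palPrefix L (toList w) ≡ true → PalPrefix w L
    from h = (n ∸ L) , eq , trans (sym (Vec.cast-is-id refl (Vec.reverse v))) (Vec.toList-injective refl _ _ (begin
        toList (Vec.reverse v)                 ≡⟨ Vec.toList-reverse v ⟩
        reverse (toList v)                     ≡⟨ cong reverse (toList-prefix eq) ⟩
        reverse (take L (toList w))            ≡⟨ isPal⇒ _ (palPrefix⇒isPal L (toList w) h) ⟩
        take L (toList w)                      ≡⟨ toList-prefix eq ⟨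
        toList v                               ∎))
      where
      L≤n : L ≤ n
      L≤n = ≤-trans (palPrefix⇒≤ L (toList w) h) (≤-reflexive (Vec.length-toList w))
      eq : n ≡ L + (n ∸ L)
      eq = sym (m+[n∸m]≡n L≤n)
      v = Vec.take L (Vec.cast eq w)

  orders : ℕ → List ℕ
  orders m = applyUpTo suc m

  ∈-orders⁺ : ∀ {i m} → 1 ≤ i → i ≤ m → i ∈ orders m
  ∈-orders⁺ {suc i} _ i<m = ∈-applyUpTo⁺ suc i<m

  ∈-orders⁻ : ∀ {i m} → i ∈ orders m → 1 ≤ i × i ≤ m
  ∈-orders⁻ i∈ with j , j<m , refl ← ∈-applyUpTo⁻ suc i∈ = s≤s z≤n , j<m

  orders-≤ : ∀ p m n → palLength p m ≤ n → All (λ i → palLength p i ≤ n) (orders m)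
  orders-≤ p m n ℓ≤n = All.tabulate (λ i∈ → ≤-trans (palLength-mono p (proj₂ (∈-orders⁻ i∈))) ℓ≤n)

  DecidedBy : (ℕ → Set) → ℕ → (ℕ → Bool) → Set
  DecidedBy S m σ = (∀ i → 1 ≤ i → S i ⇔ σ i ≡ true) × (∀ i → m < i → σ i ≡ false)

  profile-true : ∀ p σ I w → profile p σ I w ≡ true ⇔ All (λ i → palPrefix (palLength p i) w ≡ σ i) I
  profile-true p σ I w = mk⇔ (to I) (from I)
    where
    agree⇔ : ∀ b c → (if c then b else not b) ≡ true ⇔ b ≡ c
    agree⇔ true  true  = mk⇔ (λ _ → refl) (λ _ → refl)
    agree⇔ false true  = mk⇔ (λ ()) (λ ())
    agree⇔ true  false = mk⇔ (λ ()) (λ ())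
    agree⇔ false false = mk⇔ (λ _ → refl) (λ _ → refl)
    to : ∀ I → profile p σ I w ≡ true → All (λ i → palPrefix (palLength p i) w ≡ σ i) I
    to []      _ = All.[]
    to (i ∷ I) h = let (hi , hI) = ∧≡true⇒ h in
      Equivalence.to (agree⇔ (palPrefix (palLength p i) w) (σ i)) hi All.∷ to I hI
    from : ∀ I → All (λ i → palPrefix (palLength p i) w ≡ σ i) I → profile p σ I w ≡ true
    from []      All.[]         = refl
    from (i ∷ I) (hi All.∷ hI) = cong₂ _∧_ (Equivalence.from (agree⇔ (palPrefix (palLength p i) w) (σ i)) hi) (from I hI)

  profile-local : ∀ p σ a I → All (λ i → palLength p i ≤ a) I → DependsOnPrefix a (profile p σ I)
  profile-local p σ a []      _               w _   = refl
  profile-local p σ a (i ∷ I) (ℓ≤a All.∷ I≤a) w a≤ =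
    cong₂ (λ b c → (if σ i then b else not b) ∧ c)
          (palPrefix-take (palLength p i) a w ℓ≤a a≤) (profile-local p σ a I I≤a w a≤)

  too-long : ∀ p m {n} (w : Word k n) i → n ≤ suc (palLength p m) → m < i → palPrefix (palLength p i) (toList w) ≡ false
  too-long p m {n} w i n≤ m<i = palPrefix-> (palLength p i) (toList w)
    (≤-trans (s≤s (≤-trans (≤-reflexive (Vec.length-toList w)) n≤))
             (≤-trans (≤-reflexive 2+ℓ≡) (palLength-mono p m<i)))
    where
    2+ℓ≡ : suc (suc (palLength p m)) ≡ palLength p (suc m)
    2+ℓ≡ = sym (trans (cong (λ x → p + suc x) (+-suc m m)) (trans (+-suc p (suc (m + m))) (cong suc (+-suc p (m + m)))))

  OrdersExactly⇔profile : ∀ p m {n} (w : Word k n) S σ → DecidedBy S m σ → n ≤ suc (palLength p m) →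
    OrdersExactly (λ i → PalPrefix w (palLength p i)) S ⇔ profile p σ (orders m) (toList w) ≡ true
  OrdersExactly⇔profile p m w S σ (S⇔σ , σ-vanishes) n≤ = mk⇔ to from
    where
    pp⇔ : ∀ i → PalPrefix w (palLength p i) ⇔ palPrefix (palLength p i) (toList w) ≡ true
    pp⇔ i = PalPrefix⇔palPrefix w (palLength p i)
    to : OrdersExactly (λ i → PalPrefix w (palLength p i)) S → profile p σ (orders m) (toList w) ≡ true
    to exactly = Equivalence.from (profile-true p σ (orders m) (toList w)) (All.tabulate λ {i} i∈ →
      let 1≤i = proj₁ (∈-orders⁻ i∈) in
      bool-ext (Equivalence.to (S⇔σ i 1≤i) ∘ Equivalence.to (exactly i 1≤i) ∘ Equivalence.from (pp⇔ i))
               (Equivalence.to (pp⇔ i) ∘ Equivalence.from (exactly i 1≤i) ∘ Equivalence.from (S⇔σ i 1≤i)))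
    from : profile p σ (orders m) (toList w) ≡ true → OrdersExactly (λ i → PalPrefix w (palLength p i)) S
    from h i 1≤i with i ≤? m
    ... | yes i≤m =
      let pp≡σ = All.lookup (Equivalence.to (profile-true p σ (orders m) (toList w)) h) (∈-orders⁺ 1≤i i≤m) in
      mk⇔ (λ pp → Equivalence.from (S⇔σ i 1≤i) (trans (sym pp≡σ) (Equivalence.to (pp⇔ i) pp)))
          (λ s → Equivalence.from (pp⇔ i) (trans pp≡σ (Equivalence.to (S⇔σ i 1≤i) s)))
    ... | no i≰m =
      mk⇔ (λ pp → ⊥-elim (true≢false (trans (sym (Equivalence.to (pp⇔ i) pp)) (too-long p m w i n≤ (≰⇒> i≰m)))))
          (λ s → ⊥-elim (true≢false (trans (sym (Equivalence.to (S⇔σ i 1≤i) s)) (σ-vanishes i (≰⇒> i≰m)))))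
      where
      true≢false : true ≡ false → ⊥
      true≢false ()

  -- S need not be decidable, but the palindromic prefixes of any word realising S decide it.
  witness-decides : ∀ p m {n} (w : Word k n) S → OrdersExactly (λ i → PalPrefix w (palLength p i)) S →
    n ≤ suc (palLength p m) → DecidedBy S m (λ i → palPrefix (palLength p i) (toList w))
  witness-decides p m w S exactly n≤ =
    (λ i 1≤i → mk⇔ (Equivalence.to (PalPrefix⇔palPrefix w (palLength p i)) ∘ Equivalence.from (exactly i 1≤i))
                   (Equivalence.to (exactly i 1≤i) ∘ Equivalence.from (PalPrefix⇔palPrefix w (palLength p i)))) ,
    (λ i m<i → too-long p m w i n≤ m<i)

  length≡#profile : ∀ p m {n} (l : List (Word k n)) S σ → DecidedBy S m σ → n ≤ suc (palLength p m) → Unique l →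
    (∀ w → w ∈ l ⇔ OrdersExactly (λ i → PalPrefix w (palLength p i)) S) →
    length l ≡ #[ n ] (profile p σ (orders m))
  length≡#profile p m l S σ σ-decides n≤ l! l⇔ = length≡# _ l _ l! (λ w →
    let P = OrdersExactly⇔profile p m w S σ σ-decides n≤ in
    mk⇔ (Equivalence.to P ∘ Equivalence.to (l⇔ w)) (Equivalence.from (l⇔ w) ∘ Equivalence.from P))

  #-profile-suc : ∀ m σ →
    #[ suc (suc (m + m)) ] (profile 1 σ (orders m)) ≡ k * #[ suc (m + m) ] (profile 1 σ (orders m))
  #-profile-suc m σ = begin
    #[ suc n ] P                            ≡⟨ cong (#[_] P) (+-comm 1 n) ⟩
    #[ n + 1 ] P                            ≡⟨ #-cong (n + 1) on-prefix ⟩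
    #[ n + 1 ] (λ w → P (take n w) ∧ true)  ≡⟨ #-product n 1 P (λ _ _ → true) (k ^ 1) (λ _ _ _ → #-true 1) ⟩
    #[ n ] P * k ^ 1                        ≡⟨ *-comm (#[ n ] P) (k ^ 1) ⟩
    k ^ 1 * #[ n ] P                        ≡⟨ cong (_* #[ n ] P) (*-identityʳ k) ⟩
    k * #[ n ] P                            ∎
    where
    n = suc (m + m)
    P = profile 1 σ (orders m)
    on-prefix : ∀ w → length w ≡ n + 1 → P w ≡ P (take n w) ∧ true
    on-prefix w len = trans (profile-local 1 σ n (orders m) (orders-≤ 1 m n ≤-refl) w
                                           (≤-trans (m≤m+n n 1) (≤-reflexive (sym len))))
                            (sym (∧-identityʳ _))

  private
    from-some-element : ∀ {A B C : Set} (l₁ : List A) (l₂ : List B) (R : ℕ → ℕ → Set) →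
      (∀ {x} → x ∈ l₁ → C) → (∀ {y} → y ∈ l₂ → C) → (C → R (length l₁) (length l₂)) → R 0 0 →
      R (length l₁) (length l₂)
    from-some-element (x ∷ _) _        R c₁ _  r _ = r (c₁ (here refl))
    from-some-element []      (y ∷ _)  R _  c₂ r _ = r (c₂ (here refl))
    from-some-element []      []       R _  _  _ r = r

  opp≡epp : ∀ {{_ : NonZero k}} m S a b → Opp k S (suc (m + m)) a → Epp k S (suc (m + m)) b → a ≡ b
  opp≡epp m S _ _ (odd , odd! , odd⇔ , refl) (even , even! , even⇔ , refl) =
    from-some-element odd even _≡_
      (λ {w} w∈ → _ , witness-decides 1 m w S (Equivalence.to (odd⇔ w) w∈) (n≤1+n n))
      (λ {w} w∈ → _ , witness-decides 0 m w S (Equivalence.to (even⇔ w) w∈) ≤-refl)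
      (λ (σ , σ-decides) → begin
        length odd                      ≡⟨ length≡#profile 1 m odd S σ σ-decides (n≤1+n n) odd! odd⇔ ⟩
        #[ n ] (profile 1 σ (orders m)) ≡⟨ #-profile-parity n σ [] (orders m) All.[] (orders-≤ 1 m n ≤-refl) ⟨
        #[ n ] (profile 0 σ (orders m)) ≡⟨ length≡#profile 0 m even S σ σ-decides ≤-refl even! even⇔ ⟨
        length even                     ∎)
      refl
    where n = suc (m + m)

  opp≡k*epp : ∀ {{_ : NonZero k}} m S a b → Opp k S (suc (suc (m + m))) a → Epp k S (suc (m + m)) b → a ≡ k * b
  opp≡k*epp m S _ _ (odd , odd! , odd⇔ , refl) (even , even! , even⇔ , refl) =
    from-some-element odd even (λ a b → a ≡ k * b)
      (λ {w} w∈ → _ , witness-decides 1 m w S (Equivalence.to (odd⇔ w) w∈) ≤-refl)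
      (λ {w} w∈ → _ , witness-decides 0 m w S (Equivalence.to (even⇔ w) w∈) ≤-refl)
      (λ (σ , σ-decides) → begin
        length odd                              ≡⟨ length≡#profile 1 m odd S σ σ-decides ≤-refl odd! odd⇔ ⟩
        #[ suc n ] (profile 1 σ (orders m))     ≡⟨ #-profile-suc m σ ⟩
        k * #[ n ] (profile 1 σ (orders m))     ≡⟨ cong (k *_) (#-profile-parity n σ [] (orders m) All.[] (orders-≤ 1 m n ≤-refl)) ⟨
        k * #[ n ] (profile 0 σ (orders m))     ≡⟨ cong (k *_) (length≡#profile 0 m even S σ σ-decides ≤-refl even! even⇔) ⟨
        k * length even                         ∎)
      (sym (*-zeroʳ k))
    where n = suc (m + m)

theorem7 : (k n : ℕ) → 1 ≤ k → 1 ≤ n → (S : ℕ → Set) →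
    (∀ i → S i → 1 ≤ i × i ≤ n / 2) →
    ((m : ℕ) → n ≡ suc (m + m) →
    ∀ a b → Opp k S n a → Epp k S n b → a ≡ b) ×
    ((m : ℕ) → n ≡ suc (suc (m + m)) →
    ∀ a b → Opp k S n a → Epp k S (suc (m + m)) b → a ≡ k * b)
theorem7 k n 1≤k _ S _ =
  (λ m n≡ a b → subst (λ n → Opp k S n a → Epp k S n b → a ≡ b) (sym n≡) (opp≡epp m S a b)) ,
  (λ m n≡ a b → subst (λ n → Opp k S n a → Epp k S (suc (m + m)) b → a ≡ k * b) (sym n≡) (opp≡k*epp m S a b))
  where
  open ExactOrders k
  instance
    k≢0 : NonZero k
    k≢0 = >-nonZero 1≤k
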